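{- For all formulas $\phi,\psi,\theta$: if $\psi\vdash_{\mathbf{Ck}}\theta$, then $\Box_\phi\psi\vdash_{\mathbf{Ck}}\Box_\phi\theta$.
   Context: Formulas are built from propositional variables and $\bot$ using $\lnot,\supset,\land,\lor$ and a binary operator: if $\phi,\psi$ are formulas, so is $\Box_\phi\psi$. Abbreviations: $\top:=\lnot\bot$, $\Diamond_\phi\psi:=\lnot\Box_\phi\lnot\psi$. Prefixed formulas are expressions $i\triangleright\phi$ and $i\,r_\phi\,j$, where $i,j$ are positive integer indices. The $\mathbf{Ck}$ rules (premises $\Rightarrow$ conclusions; "$|$" separates branches): $i\triangleright\phi\land\psi\Rightarrow i\triangleright\phi,\ i\triangleright\psi$; $i\triangleright\lnot(\phi\land\psi)\Rightarrow i\triangleright\lnot\phi\ |\ i\triangleright\lnot\psi$; $i\triangleright\phi\lor\psi\Rightarrow i\triangleright\phi\ |\ i\triangleright\psi$; $i\triangleright\lnot(\phi\lor\psi)\Rightarrow i\triangleright\lnot\phi,\ i\triangleright\lnot\psi$; $i\triangleright\phi\supset\psi\Rightarrow i\triangleright\lnot\phi\ |\ i\triangleright\psi$; $i\triangleright\lnot(\phi\supset\psi)\Rightarrow i\triangleright\phi,\ i\triangleright\lnot\psi$; $i\triangleright\lnot\lnot\phi\Rightarrow i\triangleright\phi$; ($\Box$) $i\triangleright\Box_\phi\psi$ and $i\,r_\phi\,j\Rightarrow j\triangleright\psi$; ($\lnot\Box$) $i\triangleright\lnot\Box_\phi\psi\Rightarrow i\,r_\phi\,j,\ j\triangleright\lnot\psi$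 with $j$ new to the branch; ($\Diamond$) $i\triangleright\Diamond_\phi\psi\Rightarrow i\,r_\phi\,j,\ j\triangleright\psi$ with $j$ new; ($\lnot\Diamond$) $i\triangleright\lnot\Diamond_\phi\psi$ and $i\,r_\phi\,j\Rightarrow j\triangleright\lnot\psi$. A tableau from a set of prefixed formulas is a downward-branching tree of prefixed formulas each of which is an assumption or a conclusion of a rule applied to formulas above it on its branch (all conclusions of a branching rule placed as siblings). A branch is closed if it contains $i\triangleright\theta$ and $i\triangleright\lnot\theta$ for some $i,\theta$, or contains $i\triangleright\bot$; a tableau is closed if all its branches are. $\Gamma\vdash_{\mathbf{Ck}}\phi$ means there is a closed tableau using only these rules with assumptions $\{1\triangleright\psi:\psi\in\Gamma\}\cup\{1\triangleright\lnot\phi\}$. -}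

module Defs where

open import Data.Nat using (ℕ; _≤_)
open import Data.List using (List; []; _∷_; map; _++_)
open import Data.List.Membership.Propositional using (_∈_)
open import Data.List.Relation.Unary.All using (All)
open import Data.Product using (_×_)
open import Relation.Binary.PropositionalEquality using (_≡_)
open import Relation.Nullary using (¬_)

data Formula : Set where
  var  : ℕ → Formula
  ⊥'   : Formula
  ¬'_  : Formula → Formula
  _⊃_  : Formula → Formula → Formula
  _∧'_ : Formula → Formula → Formula
  _∨'_ : Formula → Formula → Formula
  □    : Formula → Formula → Formula   -- □ φ ψ  is  □_φ ψ

⊤' : Formula
⊤' = ¬' ⊥'

◇ : Formula → Formula → Formula
◇ φ ψ = ¬' (□ φ (¬' ψ))

-- Indices are positive integers; we use ℕ and require positivity (1 ≤ j)
-- whenever a new index is introduced; the initial index is 1.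
Index : Set
Index = ℕ

data PF : Set where
  _▷_    : Index → Formula → PF
  _r⟨_⟩_ : Index → Formula → Index → PF

data Occurs (j : Index) : PF → Set where
  occ▷  : ∀ {φ} → Occurs j (j ▷ φ)
  occrˡ : ∀ {φ k} → Occurs j (j r⟨ φ ⟩ k)
  occrʳ : ∀ {φ i} → Occurs j (i r⟨ φ ⟩ j)

Fresh : Index → List PF → Set
Fresh j B = All (λ p → ¬ Occurs j p) B

-- Closes A B : the branch B (listed from the bottom up) can be extended to a
-- closed tableau, where A is the set of assumptions (which may be added to
-- the branch at any point).  A closed tableau from A is  Closes A [].
data Closes (A : List PF) : List PF → Set where
  clash  : ∀ {B i θ} → (i ▷ θ) ∈ B → (i ▷ (¬' θ)) ∈ B → Closes A B
  bot    : ∀ {B i} → (i ▷ ⊥') ∈ B → Closes A B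
  assume : ∀ {B p} → p ∈ A → Closes A (p ∷ B) → Closes A B
  r∧   : ∀ {B i φ ψ} → (i ▷ (φ ∧' ψ)) ∈ B →
         Closes A ((i ▷ ψ) ∷ (i ▷ φ) ∷ B) → Closes A B
  r¬∧  : ∀ {B i φ ψ} → (i ▷ (¬' (φ ∧' ψ))) ∈ B →
         Closes A ((i ▷ (¬' φ)) ∷ B) → Closes A ((i ▷ (¬' ψ)) ∷ B) → Closes A B
  r∨   : ∀ {B i φ ψ} → (i ▷ (φ ∨' ψ)) ∈ B →
         Closes A ((i ▷ φ) ∷ B) → Closes A ((i ▷ ψ) ∷ B) → Closes A B
  r¬∨  : ∀ {B i φ ψ} → (i ▷ (¬' (φ ∨' ψ))) ∈ B →
         Closes A ((i ▷ (¬' ψ)) ∷ (i ▷ (¬' φ)) ∷ B) → Closes A B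
  r⊃   : ∀ {B i φ ψ} → (i ▷ (φ ⊃ ψ)) ∈ B →
         Closes A ((i ▷ (¬' φ)) ∷ B) → Closes A ((i ▷ ψ) ∷ B) → Closes A B
  r¬⊃  : ∀ {B i φ ψ} → (i ▷ (¬' (φ ⊃ ψ))) ∈ B →
         Closes A ((i ▷ (¬' ψ)) ∷ (i ▷ φ) ∷ B) → Closes A B
  r¬¬  : ∀ {B i φ} → (i ▷ (¬' (¬' φ))) ∈ B →
         Closes A ((i ▷ φ) ∷ B) → Closes A B
  r□   : ∀ {B i j φ ψ} → (i ▷ □ φ ψ) ∈ B → (i r⟨ φ ⟩ j) ∈ B →
         Closes A ((j ▷ ψ) ∷ B) → Closes A B
  r¬□  : ∀ {B i j φ ψ} → (i ▷ (¬' (□ φ ψ))) ∈ B → 1 ≤ j → Fresh j B →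
         Closes A ((j ▷ (¬' ψ)) ∷ (i r⟨ φ ⟩ j) ∷ B) → Closes A B
  r◇   : ∀ {B i j φ ψ} → (i ▷ ◇ φ ψ) ∈ B → 1 ≤ j → Fresh j B →
         Closes A ((j ▷ ψ) ∷ (i r⟨ φ ⟩ j) ∷ B) → Closes A B
  r¬◇  : ∀ {B i j φ ψ} → (i ▷ (¬' (◇ φ ψ))) ∈ B → (i r⟨ φ ⟩ j) ∈ B →
         Closes A ((j ▷ (¬' ψ)) ∷ B) → Closes A B

_⊢Ck_ : List Formula → Formula → Set
Γ ⊢Ck φ = Closes (map (1 ▷_) Γ ++ ((1 ▷ (¬' φ)) ∷ [])) []

module Submission where

-- Let T be a closed tableau for ψ ⊢ θ, i.e. from the
-- assumptions 1 ▷ ψ and 1 ▷ ¬θ.  For □_φ ψ ⊢ □_φ θ we start from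
-- 1 ▷ □_φ ψ and 1 ▷ ¬□_φ θ, apply (¬□) to get 1 r_φ 2 and 2 ▷ ¬θ, and then
-- (□) to get 2 ▷ ψ.  The rest of the tableau is T relocated to world 2:
-- every prefixed formula of T is renamed by a map on indices that sends 1 to
-- 2.  The renaming has to be adjusted whenever T introduces a new index with
-- (¬□) or (◇), since the new index of T need not be new to the target branch.
--
-- The theorem
-- then follows by peeling off the first step of T, which must introduce an
-- assumption, and transporting the rest with the constant renaming to 2.

open import Defs
open import Data.List using (List; []; _∷_; map)
open import Data.Nat using (ℕ; suc; _≤_; _⊔_; z≤n; s≤s; _≟_)
open import Data.Nat.Properties using (≤-trans; m≤m⊔n; m≤n⊔m; ≤-refl; n≮n)
open import Data.List.Membership.Propositional using (_∈_)
open import Data.List.Membership.Propositional.Properties using (∈-map⁻)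
open import Data.List.Relation.Unary.Any using (here; there)
open import Data.List.Relation.Unary.All using ([]; _∷_; lookup)
open import Data.Product using (∃; _×_; _,_)
open import Relation.Binary.PropositionalEquality using (_≡_; refl; sym; subst; cong; cong₂)
open import Relation.Nullary using (¬_; yes; no)
open import Data.Empty using (⊥-elim)

ren : (ℕ → ℕ) → PF → PF
ren g (i ▷ φ) = g i ▷ φ
ren g (i r⟨ φ ⟩ j) = g i r⟨ φ ⟩ g j

update : (ℕ → ℕ) → ℕ → ℕ → ℕ → ℕ
update g j k n with n ≟ j
... | yes _ = k
... | no _ = g n

update-same : ∀ g j k → update g j k j ≡ k
update-same g j k with j ≟ j
... | yes _ = refl
... | no j≢j = ⊥-elim (j≢j refl)

update-other : ∀ g j k n → ¬ n ≡ j → update g j k n ≡ g n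
update-other g j k n n≢j with n ≟ j
... | yes n≡j = ⊥-elim (n≢j n≡j)
... | no _ = refl

ren-update-away : ∀ g j k p → ¬ Occurs j p → ren (update g j k) p ≡ ren g p
ren-update-away g j k (i ▷ φ) j∉p =
  cong (_▷ φ) (update-other g j k i (λ { refl → j∉p occ▷ }))
ren-update-away g j k (i r⟨ φ ⟩ l) j∉p =
  cong₂ (_r⟨ φ ⟩_) (update-other g j k i (λ { refl → j∉p occrˡ }))
                   (update-other g j k l (λ { refl → j∉p occrʳ }))

maxIndexPF : PF → ℕ
maxIndexPF (i ▷ _) = i
maxIndexPF (i r⟨ _ ⟩ j) = i ⊔ j

maxIndex : List PF → ℕ
maxIndex [] = 0
maxIndex (p ∷ B) = maxIndexPF p ⊔ maxIndex B

occurs≤max : ∀ {n p} → Occurs n p → n ≤ maxIndexPF p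
occurs≤max occ▷ = ≤-refl
occurs≤max {p = i r⟨ _ ⟩ j} occrˡ = m≤m⊔n i j
occurs≤max {p = i r⟨ _ ⟩ j} occrʳ = m≤n⊔m i j

fresh-above : ∀ B m → maxIndex B ≤ m → Fresh (suc m) B
fresh-above [] m _ = []
fresh-above (p ∷ B) m B≤m =
  (λ o → n≮n m (≤-trans (occurs≤max o) (≤-trans (m≤m⊔n (maxIndexPF p) (maxIndex B)) B≤m)))
  ∷ fresh-above B m (≤-trans (m≤n⊔m (maxIndexPF p) (maxIndex B)) B≤m)

nextIndex : List PF → ℕ
nextIndex B = suc (maxIndex B)

nextIndex-fresh : ∀ B → Fresh (nextIndex B) B
nextIndex-fresh B = fresh-above B (maxIndex B) ≤-refl

-- Every index of the assumptions A already occurs on the branch B.  Then an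
-- index new to B does not occur in A, so redirecting it keeps A in place.
Covers : List PF → List PF → Set
Covers B A = ∀ {j p} → p ∈ A → Occurs j p → ∃ λ q → q ∈ B × Occurs j q

fresh-not-in-covered : ∀ {A B j p} → Covers B A → Fresh j B → p ∈ A → ¬ Occurs j p
fresh-not-in-covered cov fr p∈A o with cov p∈A o
... | q , q∈B , o' = lookup fr q∈B o'

root-covers : ∀ {Δ p} → p ∈ map (1 ▷_) Δ → Covers (p ∷ []) (map (1 ▷_) Δ)
root-covers p∈A q∈A o with ∈-map⁻ (1 ▷_) q∈A | ∈-map⁻ (1 ▷_) p∈A
... | _ , _ , refl | _ , _ , refl with o
...   | occ▷ = _ , here refl , occ▷

covers-cons : ∀ {A B} q → Covers B A → Covers (q ∷ B) A
covers-cons q cov p∈A o with cov p∈A o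
... | r , r∈B , o' = r , there r∈B , o'

module Transport {A A' : List PF} where

  record Embeds (g : ℕ → ℕ) (B B' : List PF) : Set where
    field
      branch      : ∀ {p} → p ∈ B → ren g p ∈ B'
      assumptions : ∀ {p} → p ∈ A → ren g p ∈ B'
      covered     : Covers B A
  open Embeds

  extend : ∀ {g B B'} q → Embeds g B B' → Embeds g (q ∷ B) (ren g q ∷ B')
  extend q E .branch (here refl) = here refl
  extend q E .branch (there p∈B) = there (E .branch p∈B)
  extend q E .assumptions p∈A = there (E .assumptions p∈A)
  extend q E .covered = covers-cons q (E .covered)

  include : ∀ {g B B' p} → p ∈ A → Embeds g B B' → Embeds g (p ∷ B) B'
  include p∈A E .branch (here refl) = E .assumptions p∈A
  include p∈A E .branch (there m) = E .branch m
  include p∈A E .assumptions = E .assumptions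
  include p∈A E .covered = covers-cons _ (E .covered)

  redirect : ∀ {g B B' j} k → Fresh j B → Embeds g B B' → Embeds (update g j k) B B'
  redirect {g} {B' = B'} {j} k fr E .branch {p} p∈B =
    subst (_∈ B') (sym (ren-update-away g j k p (lookup fr p∈B))) (E .branch p∈B)
  redirect {g} {B' = B'} {j} k fr E .assumptions {p} p∈A =
    subst (_∈ B') (sym (ren-update-away g j k p (fresh-not-in-covered (E .covered) fr p∈A)))
      (E .assumptions p∈A)
  redirect k fr E .covered = E .covered

  redirected-fresh : ∀ g j B' → let k = update g j (nextIndex B') j in 1 ≤ k × Fresh k B'
  redirected-fresh g j B' rewrite update-same g j (nextIndex B') = s≤s z≤n , nextIndex-fresh B'

  -- Transport: every rule of the source tableau is replayed on the images;
  -- for (¬□) and (◇) the new source index is first redirected to an index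
  -- new to the target branch.
  transport : ∀ {g B B'} → Closes A B → Embeds g B B' → Closes A' B'
  transport (clash m m') E = clash (E .branch m) (E .branch m')
  transport (bot m) E = bot (E .branch m)
  transport (assume p∈A c) E = transport c (include p∈A E)
  transport (r∧ m c) E = r∧ (E .branch m) (transport c (extend _ (extend _ E)))
  transport (r¬∧ m c c') E = r¬∧ (E .branch m) (transport c (extend _ E)) (transport c' (extend _ E))
  transport (r∨ m c c') E = r∨ (E .branch m) (transport c (extend _ E)) (transport c' (extend _ E))
  transport (r¬∨ m c) E = r¬∨ (E .branch m) (transport c (extend _ (extend _ E)))
  transport (r⊃ m c c') E = r⊃ (E .branch m) (transport c (extend _ E)) (transport c' (extend _ E))
  transport (r¬⊃ m c) E = r¬⊃ (E .branch m) (transport c (extend _ (extend _ E)))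
  transport (r¬¬ m c) E = r¬¬ (E .branch m) (transport c (extend _ E))
  transport (r□ m m' c) E = r□ (E .branch m) (E .branch m') (transport c (extend _ E))
  transport (r¬◇ m m' c) E = r¬◇ (E .branch m) (E .branch m') (transport c (extend _ E))
  transport {g} {B' = B'} (r¬□ {j = j} m _ fr c) E
    with redirected-fresh g j B'
  ... | pos , fresh = r¬□ (E' .branch m) pos fresh (transport c (extend _ (extend _ E')))
    where E' = redirect (nextIndex B') fr E
  transport {g} {B' = B'} (r◇ {j = j} m _ fr c) E
    with redirected-fresh g j B'
  ... | pos , fresh = r◇ (E' .branch m) pos fresh (transport c (extend _ (extend _ E')))
    where E' = redirect (nextIndex B') fr E

open Transport using (transport)

-- A closed tableau can only start by introducing an assumption, since every
-- other rule needs a premise on the (empty) branch.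
first-assumption : ∀ {A} → Closes A [] → ∃ λ p → p ∈ A × Closes A (p ∷ [])
first-assumption (assume p∈A c) = _ , p∈A , c
first-assumption (clash () _)
first-assumption (bot ())
first-assumption (r∧ () _)
first-assumption (r¬∧ () _ _)
first-assumption (r∨ () _ _)
first-assumption (r¬∨ () _)
first-assumption (r⊃ () _ _)
first-assumption (r¬⊃ () _)
first-assumption (r¬¬ () _)
first-assumption (r□ () _ _)
first-assumption (r¬□ () _ _ _)
first-assumption (r◇ () _ _ _)
first-assumption (r¬◇ () _ _)

proposition2 : (φ ψ θ : Formula) → (ψ ∷ []) ⊢Ck θ → (□ φ ψ ∷ []) ⊢Ck □ φ θ
proposition2 φ ψ θ T with first-assumption T
... | p , p∈A , T' =
  assume (there (here refl))                                  -- 1 ▷ ¬□_φ θ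
    (r¬□ {j = 2} (here refl) (s≤s z≤n) ((λ ()) ∷ [])         -- 1 r_φ 2, 2 ▷ ¬θ
      (assume (here refl)                                     -- 1 ▷ □_φ ψ
        (r□ (here refl) (there (there (here refl)))           -- 2 ▷ ψ
          (transport T' embedding))))
  where
  atWorld2 : ℕ → ℕ
  atWorld2 _ = 2
  relocated : ∀ {q} → q ∈ map (1 ▷_) (ψ ∷ ¬' θ ∷ []) →
              ren atWorld2 q ∈ ((2 ▷ ψ) ∷ (1 ▷ □ φ ψ) ∷ (2 ▷ (¬' θ)) ∷ _)
  relocated (here refl) = here refl
  relocated (there (here refl)) = there (there (here refl))
  embedding : Transport.Embeds atWorld2 (p ∷ []) _
  embedding = record { branch      = λ { (here refl) → relocated p∈A }
                     ; assumptions = relocated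
                     ; covered     = root-covers p∈A }
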